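{- Let $M$ be an internally $4$-connected binary matroid such that $\{1,2,3\}$ and $\{4,5,6\}$ are disjoint triangles, $\{2,3,4,5\}$ is a cocircuit, and $\{2,4,7\}$ is a triangle of $M$. Let $N$ be an internally $4$-connected matroid with at least seven elements such that $N$ is isomorphic to a minor of $M/\{x,y\}$ for some two-element subset $\{x,y\}$ of $\{4,5,6\}$. Then $M\backslash 1,4$ has an $N$-minor.
   Context: Triangle = $3$-element circuit. For a matroid $M$ on $E$ with rank function $r$, $\lambda_M(X)=r(X)+r(E-X)-r(M)$; a $k$-separation is a partition $(X,Y)$ with $\lambda_M(X)\le k-1$ and $|X|,|Y|\ge k$; $M$ is $3$-connected if it has no $1$- or $2$-separation, and internally $4$-connected if moreover for every $3$-separation one side is a triangle or a $3$-element cocircuit. "Has an $N$-minor" means has a minor isomorphic to $N$. -}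

module Defs where

open import Data.Nat using (ℕ; zero; suc; _+_; _∸_; _≤_; _<_)
open import Data.Bool using (Bool; true; false; if_then_else_; _xor_)
open import Data.Fin using (Fin; zero; suc)
open import Data.Fin.Subset public
  using (Subset; _∈_; _∉_; _⊆_; _⊂_; _∪_; _∩_; ∁; ⁅_⁆; ⊥; ⊤; ∣_∣; Empty)
open import Data.Vec using (Vec; []; _∷_; replicate; zipWith)
open import Data.Product using (Σ; _×_; ∃)
open import Data.Sum using (_⊎_)
open import Relation.Binary.PropositionalEquality using (_≡_; _≢_)
open import Relation.Nullary using (¬_)
open import Function using (_∘_)
open import Function.Definitions using (Injective)

record Matroid (n : ℕ) : Set where
  field
    rk        : Subset n → ℕ
    rk-bound  : ∀ X → rk X ≤ ∣ X ∣
    rk-mono   : ∀ X Y → X ⊆ Y → rk X ≤ rk Y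
    rk-submod : ∀ X Y → rk (X ∪ Y) + rk (X ∩ Y) ≤ rk X + rk Y
open Matroid public

module _ {n : ℕ} where

  Indep : (Subset n → ℕ) → Subset n → Set
  Indep r X = r X ≡ ∣ X ∣

  Circuit : (Subset n → ℕ) → Subset n → Set
  Circuit r C = (r C < ∣ C ∣) × (∀ Y → Y ⊂ C → Indep r Y)

  dualRk : Matroid n → Subset n → ℕ
  dualRk M X = (∣ X ∣ + rk M (∁ X)) ∸ rk M ⊤

  IsCircuit : Matroid n → Subset n → Set
  IsCircuit M = Circuit (rk M)

  IsCocircuit : Matroid n → Subset n → Set
  IsCocircuit M = Circuit (dualRk M)

  IsTriangle : Matroid n → Subset n → Set
  IsTriangle M X = IsCircuit M X × ∣ X ∣ ≡ 3

  IsTriad : Matroid n → Subset n → Set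
  IsTriad M X = IsCocircuit M X × ∣ X ∣ ≡ 3

  conn : Matroid n → Subset n → ℕ
  conn M X = (rk M X + rk M (∁ X)) ∸ rk M ⊤

  IsSeparation : ℕ → Matroid n → Subset n → Set
  IsSeparation k M X = (suc (conn M X) ≤ k) × (k ≤ ∣ X ∣) × (k ≤ ∣ ∁ X ∣)

  ThreeConnected : Matroid n → Set
  ThreeConnected M = ∀ X → ¬ IsSeparation 1 M X × ¬ IsSeparation 2 M X

  InternallyFourConnected : Matroid n → Set
  InternallyFourConnected M =
    ThreeConnected M ×
    (∀ X → IsSeparation 3 M X →
       (IsTriangle M X ⊎ IsTriad M X) ⊎ (IsTriangle M (∁ X) ⊎ IsTriad M (∁ X)))

-- GF(2) linear algebra: vectors in GF(2)^m are Vec Bool m, addition is xor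
sumOver : ∀ {n m} → Subset n → (Fin n → Vec Bool m) → Vec Bool m
sumOver {m = m} [] v = replicate m false
sumOver (b ∷ S) v =
  zipWith _xor_ (if b then v zero else replicate _ false) (sumOver S (v ∘ suc))

LinIndep : ∀ {n m} → (Fin n → Vec Bool m) → Subset n → Set
LinIndep {m = m} v I = ∀ S → S ⊆ I → sumOver S v ≡ replicate m false → Empty S

Binary : ∀ {n} → Matroid n → Set
Binary {n} M = Σ ℕ λ m → Σ (Fin n → Vec Bool m) λ v →
  ∀ I → (Indep (rk M) I → LinIndep v I) × (LinIndep v I → Indep (rk M) I)

img : ∀ {k n} → (Fin k → Fin n) → Subset k → Subset n
img φ [] = ⊥
img φ (b ∷ X) = (if b then ⁅ φ zero ⁆ else ⊥) ∪ img (φ ∘ suc) X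

-- N ≅ M / C \ D  (C, D disjoint; rank of the minor is r(X ∪ C) - r(C))
IsoMinor : ∀ {n k} → Matroid n → Subset n → Subset n → Matroid k → Set
IsoMinor {n} {k} M C D N =
  Empty (C ∩ D) ×
  Σ (Fin k → Fin n) λ φ →
    Injective _≡_ _≡_ φ ×
    (∀ j → φ j ∉ C ∪ D) ×
    (∀ i → i ∉ C ∪ D → ∃ λ j → φ j ≡ i) ×
    (∀ X → rk N X + rk M C ≡ rk M (img φ X ∪ C))

-- N is isomorphic to a minor of M / C₀ \ D₀  (C₀ ∩ D₀ = ∅):
-- the minors of M / C₀ \ D₀ are exactly the M / C \ D with C₀ ⊆ C, D₀ ⊆ D.
HasMinorOf : ∀ {n k} → Matroid n → Subset n → Subset n → Matroid k → Set
HasMinorOf M C₀ D₀ N =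
  Σ _ λ C → Σ _ λ D → C₀ ⊆ C × D₀ ⊆ D × IsoMinor M C D N

-- An N-minor M / C \ D is transformed by two moves.  First, an element outside C ∪ D that lies in
-- the closure of C would be a loop of N, and two such elements of rank one over C a parallel
-- pair; both are impossible as N is 3-connected with at least four elements, so such elements
-- may be assumed to lie in C ∪ D, and a loop of M / (C - e) in C can be deleted instead.
-- Secondly, the transposition of two elements that are parallel in M / A with A ⊆ C, or in
-- series in M \ B with B ⊆ D, preserves every rank the minor depends on.
-- Starting from M / x, y with x, y ∈ {4,5,6}, this yields N-minors of M / 5,6 \ 4 (triangle
-- {4,5,6}), M / 5 \ 2,4 (2 and 7 are parallel in M / 5,6 since 4 is a loop there),
-- M / 3 \ 2,4 (3 and 5 are in series in M \ 2,4 by the cocircuit {2,3,4,5}), and finally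
-- M \ 1,4 (1 and 2 are parallel in M / 3).  Only the 3-connectivity of N and |E(N)| ≥ 4 are
-- used.

module Submission where

open import Defs
open import Data.Nat using (ℕ; suc; _+_; _∸_; _≤_; _<_; z≤n; s≤s; _≤?_)
open import Data.Nat.Properties
  using (≤-trans; ≤-antisym; ≤-reflexive; +-comm; +-mono-≤; +-monoˡ-≤; +-monoʳ-≤;
         m≤m+n; n≤1+n; +-monoʳ-<; ≤-pred; n≮n; +-suc; +-cancelʳ-≤; +-∸-assoc; m<n+o⇒m∸n<o;
         ≰⇒>; <⇒≱; n≤0⇒n≡0; m+n∸n≡m;
         ∸-monoˡ-≤; ∸-monoʳ-≤; module ≤-Reasoning)
open import Data.Fin using (Fin; zero; suc)
open import Data.Fin.Properties using (_≟_)
open import Data.Fin.Subset using (_-_; _─_)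
open import Data.Bool using (true; false; if_then_else_)
open import Data.Fin.Subset.Properties
  using (x∈⁅x⁆; x∈⁅y⁆⇒x≡y; ∣⁅x⁆∣≡1; p⊆q⇒∣p∣≤∣q∣; ⊆-refl; ⊆-reflexive; ⊆-trans; ⊆-antisym; ⊆⊤; ∉⊥; _∈?_;
         x∈p∪q⁻; x∈p∪q⁺; p⊆p∪q; q⊆p∪q; x∈p∩q⁺; x∈p∩q⁻; x∉p⇒x∈∁p; x∈∁p⇒x∉p; ∣∁p∣≡n∸∣p∣;
         p─q⊆p; ⊥⊆; x∈p∧x≢y⇒x∈p-y; x∈p⇒p-x⊂p; ∪-assoc; ∪-comm; ∪-idem; nonempty?; p⊂q⇒∣p∣<∣q∣; x≢y⇒x∉⁅y⁆)
open import Data.Fin.Permutation.Components using (transpose)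
open import Data.Vec using ([]; _∷_; lookup; tabulate; here; there)
open import Data.Vec.Properties using (lookup∘tabulate; []=⇒lookup; lookup⇒[]=)
open import Data.Product using (_×_; _,_; ∃; ∃₂; proj₁; proj₂)
open import Data.Sum using (_⊎_; inj₁; inj₂; [_,_])
import Data.Sum as Sum
open import Data.Empty using (⊥-elim)
open import Relation.Binary.PropositionalEquality
  using (_≡_; _≢_; refl; sym; trans; cong; cong₂; subst; ≢-sym; module ≡-Reasoning)
open import Relation.Nullary using (¬_; Dec; yes; no)
open import Function using (_∘_)

x∈p─q⇒x∉q : ∀ {n} {x : Fin n} (p q : Subset n) → x ∈ p ─ q → x ∉ q
x∈p─q⇒x∉q (_ ∷ p) (true ∷ q) () here
x∈p─q⇒x∉q (_ ∷ p) (_ ∷ q) (there x∈) (there x∈q) = x∈p─q⇒x∉q p q x∈ x∈q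

module _ {n : ℕ} where

  x∈⁅y⁆∪p⁻ : ∀ {x y : Fin n} {p} → x ∈ ⁅ y ⁆ ∪ p → x ≡ y ⊎ x ∈ p
  x∈⁅y⁆∪p⁻ {y = y} {p} x∈ = Sum.map₁ (x∈⁅y⁆⇒x≡y y) (x∈p∪q⁻ ⁅ y ⁆ p x∈)

  x∈⁅x⁆∪p : ∀ {x : Fin n} {p} → x ∈ ⁅ x ⁆ ∪ p
  x∈⁅x⁆∪p = x∈p∪q⁺ (inj₁ (x∈⁅x⁆ _))

  x∈p⇒x∈⁅y⁆∪p : ∀ {x y : Fin n} {p} → x ∈ p → x ∈ ⁅ y ⁆ ∪ p
  x∈p⇒x∈⁅y⁆∪p = x∈p∪q⁺ ∘ inj₂

  x∈⁅a⁆∪⁅b⁆∪⁅c⁆⁻ : ∀ {x a b c : Fin n} → x ∈ ⁅ a ⁆ ∪ ⁅ b ⁆ ∪ ⁅ c ⁆ → x ≡ a ⊎ x ≡ b ⊎ x ≡ c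
  x∈⁅a⁆∪⁅b⁆∪⁅c⁆⁻ x∈ = Sum.map₂ (Sum.map₂ (x∈⁅y⁆⇒x≡y _) ∘ x∈⁅y⁆∪p⁻) (x∈⁅y⁆∪p⁻ x∈)

  x∉p∧x∉q⇒x∉p∪q : ∀ {x : Fin n} {p q} → x ∉ p → x ∉ q → x ∉ p ∪ q
  x∉p∧x∉q⇒x∉p∪q {p = p} {q} x∉p x∉q x∈ = [ x∉p , x∉q ] (x∈p∪q⁻ p q x∈)

  p⊆r∧q⊆r⇒p∪q⊆r : ∀ {p q r : Subset n} → p ⊆ r → q ⊆ r → p ∪ q ⊆ r
  p⊆r∧q⊆r⇒p∪q⊆r {p} {q} p⊆r q⊆r x∈ = [ p⊆r , q⊆r ] (x∈p∪q⁻ p q x∈)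

  x∈q⇒⁅x⁆⊆q : ∀ {x : Fin n} {q} → x ∈ q → ⁅ x ⁆ ⊆ q
  x∈q⇒⁅x⁆⊆q {x} x∈q y∈ rewrite x∈⁅y⁆⇒x≡y x y∈ = x∈q

  ∪-mono-⊆ : ∀ {p p′ q q′ : Subset n} → p ⊆ p′ → q ⊆ q′ → p ∪ q ⊆ p′ ∪ q′
  ∪-mono-⊆ {p′ = p′} {q′ = q′} p⊆ q⊆ = p⊆r∧q⊆r⇒p∪q⊆r (p⊆p∪q q′ ∘ p⊆) (q⊆p∪q p′ q′ ∘ q⊆)

  x∈p-y⇒x≢y : ∀ {x y : Fin n} {p} → x ∈ p - y → x ≢ y
  x∈p-y⇒x≢y {y = y} {p} x∈ refl = x∈p─q⇒x∉q p ⁅ y ⁆ x∈ (x∈⁅x⁆ y)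

  p-x≡p : ∀ {x : Fin n} {p} → x ∉ p → p - x ≡ p
  p-x≡p {x} {p} x∉p =
    ⊆-antisym (p─q⊆p p ⁅ x ⁆) (λ y∈p → x∈p∧x≢y⇒x∈p-y y∈p λ { refl → x∉p y∈p })

  [p-x]∪⁅x⁆≡p : ∀ {x : Fin n} {p} → x ∈ p → (p - x) ∪ ⁅ x ⁆ ≡ p
  [p-x]∪⁅x⁆≡p {x} {p} x∈p = ⊆-antisym (p⊆r∧q⊆r⇒p∪q⊆r (p─q⊆p p ⁅ x ⁆) (x∈q⇒⁅x⁆⊆q x∈p)) split
    where
    split : p ⊆ (p - x) ∪ ⁅ x ⁆
    split {y} y∈p with y ≟ x
    ... | yes refl = q⊆p∪q (p - x) ⁅ x ⁆ (x∈⁅x⁆ x)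
    ... | no y≢x = p⊆p∪q ⁅ x ⁆ (x∈p∧x≢y⇒x∈p-y y∈p y≢x)

∣p∪q∣≤∣p∣+∣q∣ : ∀ {n} (p q : Subset n) → ∣ p ∪ q ∣ ≤ ∣ p ∣ + ∣ q ∣
∣p∪q∣≤∣p∣+∣q∣ [] [] = z≤n
∣p∪q∣≤∣p∣+∣q∣ (true ∷ p) (true ∷ q) = s≤s (≤-trans (∣p∪q∣≤∣p∣+∣q∣ p q) (+-monoʳ-≤ ∣ p ∣ (n≤1+n ∣ q ∣)))
∣p∪q∣≤∣p∣+∣q∣ (true ∷ p) (false ∷ q) = s≤s (∣p∪q∣≤∣p∣+∣q∣ p q)
∣p∪q∣≤∣p∣+∣q∣ (false ∷ p) (true ∷ q) rewrite +-suc ∣ p ∣ ∣ q ∣ = s≤s (∣p∪q∣≤∣p∣+∣q∣ p q)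
∣p∪q∣≤∣p∣+∣q∣ (false ∷ p) (false ∷ q) = ∣p∪q∣≤∣p∣+∣q∣ p q

x∈p⇒0<∣p∣ : ∀ {n} {x : Fin n} {p} → x ∈ p → 0 < ∣ p ∣
x∈p⇒0<∣p∣ {x = x} x∈p = subst (_≤ _) (∣⁅x⁆∣≡1 x) (p⊆q⇒∣p∣≤∣q∣ (x∈q⇒⁅x⁆⊆q x∈p))

∣⁅x⁆∪⁅y⁆∣≤2 : ∀ {n} (x y : Fin n) → ∣ ⁅ x ⁆ ∪ ⁅ y ⁆ ∣ ≤ 2
∣⁅x⁆∪⁅y⁆∣≤2 x y = ≤-trans (∣p∪q∣≤∣p∣+∣q∣ ⁅ x ⁆ ⁅ y ⁆) (≤-reflexive (cong₂ _+_ (∣⁅x⁆∣≡1 x) (∣⁅x⁆∣≡1 y)))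

-- Transposing two elements

module _ {n : ℕ} (a b : Fin n) where

  transpose-ab-a : transpose a b a ≡ b
  transpose-ab-a with a ≟ a
  ... | yes _ = refl
  ... | no a≢a = ⊥-elim (a≢a refl)

  transpose-ab-b : transpose a b b ≡ a
  transpose-ab-b with b ≟ a
  ... | yes b≡a = b≡a
  ... | no _ with b ≟ b
  ...   | yes _ = refl
  ...   | no b≢b = ⊥-elim (b≢b refl)

  transpose-fix : ∀ {x} → x ≢ a → x ≢ b → transpose a b x ≡ x
  transpose-fix {x} x≢a x≢b with x ≟ a
  ... | yes x≡a = ⊥-elim (x≢a x≡a)
  ... | no _ with x ≟ b
  ...   | yes x≡b = ⊥-elim (x≢b x≡b)
  ...   | no _ = refl

  transpose-involutive : ∀ x → transpose a b (transpose a b x) ≡ x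
  transpose-involutive x with x ≟ a
  ... | yes refl = transpose-ab-b
  ... | no x≢a with x ≟ b
  ...   | yes refl = transpose-ab-a
  ...   | no x≢b = transpose-fix x≢a x≢b

  -- the image of p under the transposition (a b), which is its own inverse
  swap : Subset n → Subset n
  swap p = tabulate (lookup p ∘ transpose a b)

  x∈swap⁺ : ∀ {x p} → transpose a b x ∈ p → x ∈ swap p
  x∈swap⁺ {x} {p} tx∈p = lookup⇒[]= x (swap p) (trans (lookup∘tabulate _ x) ([]=⇒lookup tx∈p))

  x∈swap⁻ : ∀ {x p} → x ∈ swap p → transpose a b x ∈ p
  x∈swap⁻ {x} {p} x∈ = lookup⇒[]= _ p (trans (sym (lookup∘tabulate _ x)) ([]=⇒lookup x∈))

  tx∈swap⁺ : ∀ {x p} → x ∈ p → transpose a b x ∈ swap p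
  tx∈swap⁺ {x} {p} x∈p = x∈swap⁺ (subst (_∈ p) (sym (transpose-involutive x)) x∈p)

  tx∈swap⁻ : ∀ {x p} → transpose a b x ∈ swap p → x ∈ p
  tx∈swap⁻ {x} {p} tx∈ = subst (_∈ p) (transpose-involutive x) (x∈swap⁻ tx∈)

  a∈swap : ∀ {p} → b ∈ p → a ∈ swap p
  a∈swap b∈p = x∈swap⁺ (subst (_∈ _) (sym transpose-ab-a) b∈p)

  b∈swap : ∀ {p} → a ∈ p → b ∈ swap p
  b∈swap a∈p = x∈swap⁺ (subst (_∈ _) (sym transpose-ab-b) a∈p)

  x∈swap-fix : ∀ {x p} → x ∈ p → x ≢ a → x ≢ b → x ∈ swap p
  x∈swap-fix {x} {p} x∈p x≢a x≢b = x∈swap⁺ (subst (_∈ p) (sym (transpose-fix x≢a x≢b)) x∈p)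

  p⊆swap : ∀ {p q} → p ⊆ q → a ∉ p → b ∉ p → p ⊆ swap q
  p⊆swap p⊆q a∉p b∉p x∈p = x∈swap-fix (p⊆q x∈p) (λ { refl → a∉p x∈p }) (λ { refl → b∉p x∈p })

  swap-mono : ∀ {p q} → p ⊆ q → swap p ⊆ swap q
  swap-mono p⊆q = x∈swap⁺ ∘ p⊆q ∘ x∈swap⁻

  swap-∪ : ∀ p q → swap (p ∪ q) ≡ swap p ∪ swap q
  swap-∪ p q = ⊆-antisym split
    (p⊆r∧q⊆r⇒p∪q⊆r (swap-mono {p} (p⊆p∪q q)) (swap-mono {q} (q⊆p∪q p q)))
    where
    split : swap (p ∪ q) ⊆ swap p ∪ swap q
    split x∈ with x∈p∪q⁻ p q (x∈swap⁻ x∈)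
    ... | inj₁ tx∈p = p⊆p∪q (swap q) (x∈swap⁺ tx∈p)
    ... | inj₂ tx∈q = q⊆p∪q (swap p) (swap q) (x∈swap⁺ tx∈q)

  swap-⁅⁆ : ∀ x → swap ⁅ x ⁆ ≡ ⁅ transpose a b x ⁆
  swap-⁅⁆ x = ⊆-antisym
    (λ {y} y∈ → subst (_∈ ⁅ transpose a b x ⁆)
       (trans (cong (transpose a b) (sym (x∈⁅y⁆⇒x≡y x (x∈swap⁻ y∈)))) (transpose-involutive y))
       (x∈⁅x⁆ _))
    (x∈q⇒⁅x⁆⊆q (tx∈swap⁺ (x∈⁅x⁆ x)))

  swap-fixes : ∀ {p} → (a ∈ p → b ∈ p) → (b ∈ p → a ∈ p) → swap p ≡ p
  swap-fixes {p} a⇒b b⇒a = ⊆-antisym (λ x∈ → fixed _ (x∈swap⁻ x∈)) (λ x∈p → x∈swap⁺ (moved _ x∈p))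
    where
    fixed : ∀ x → transpose a b x ∈ p → x ∈ p
    fixed x tx∈p with x ≟ a
    ... | yes refl = b⇒a tx∈p
    ... | no x≢a with x ≟ b
    ...   | yes refl = a⇒b tx∈p
    ...   | no x≢b = tx∈p
    moved : ∀ x → x ∈ p → transpose a b x ∈ p
    moved x x∈p = fixed (transpose a b x) (subst (_∈ p) (sym (transpose-involutive x)) x∈p)

  swap-∪⁅⁆ : ∀ {U} x → a ∉ U → b ∉ U → swap (U ∪ ⁅ x ⁆) ≡ U ∪ ⁅ transpose a b x ⁆
  swap-∪⁅⁆ {U} x a∉U b∉U = begin
    swap (U ∪ ⁅ x ⁆)                ≡⟨ swap-∪ U ⁅ x ⁆ ⟩
    swap U ∪ swap ⁅ x ⁆             ≡⟨ cong₂ _∪_ (swap-fixes (⊥-elim ∘ a∉U) (⊥-elim ∘ b∉U)) (swap-⁅⁆ x) ⟩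
    U ∪ ⁅ transpose a b x ⁆         ∎
    where open ≡-Reasoning

-- Rank, closure, circuits and cocircuits

m+n∸o<m⇒n<o : ∀ m n o → m + n ∸ o < m → n < o
m+n∸o<m⇒n<o m n o lt with o ≤? n
... | no o≰n = ≰⇒> o≰n
... | yes o≤n = ⊥-elim (<⇒≱ lt (subst (m ≤_) (sym (+-∸-assoc m o≤n)) (m≤m+n m (n ∸ o))))

m+n∸o≡m⇒o≤n : ∀ m n o → 0 < m → m + n ∸ o ≡ m → o ≤ n
m+n∸o≡m⇒o≤n (suc m) n o _ eq with o ≤? n
... | yes o≤n = o≤n
... | no o≰n = ⊥-elim (<⇒≱ (m<n+o⇒m∸n<o (suc m + n) o m+n<o+m) (≤-reflexive (sym eq)))
  where
  m+n<o+m : suc m + n < o + suc m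
  m+n<o+m = subst (suc m + n <_) (+-comm (suc m) o) (+-monoʳ-< (suc m) (≰⇒> o≰n))

module _ {n : ℕ} (M : Matroid n) where

  private
    r : Subset n → ℕ
    r = rk M

    r-mono : ∀ {A B} → A ⊆ B → r A ≤ r B
    r-mono = rk-mono M _ _

  InClosure : Subset n → Fin n → Set
  InClosure A e = r (A ∪ ⁅ e ⁆) ≤ r A

  rk-∪⁅⁆≤ : ∀ A e → r (A ∪ ⁅ e ⁆) ≤ suc (r A)
  rk-∪⁅⁆≤ A e = begin
    r (A ∪ ⁅ e ⁆)                  ≤⟨ m≤m+n _ _ ⟩
    r (A ∪ ⁅ e ⁆) + r (A ∩ ⁅ e ⁆)  ≤⟨ rk-submod M A ⁅ e ⁆ ⟩
    r A + r ⁅ e ⁆                  ≤⟨ +-monoʳ-≤ (r A) (subst (r ⁅ e ⁆ ≤_) (∣⁅x⁆∣≡1 e) (rk-bound M ⁅ e ⁆)) ⟩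
    r A + 1                        ≡⟨ +-comm (r A) 1 ⟩
    suc (r A)                      ∎
    where open ≤-Reasoning

  submodular-⊆ : ∀ {A B} S → A ⊆ B → r (B ∪ S) + r A ≤ r (A ∪ S) + r B
  submodular-⊆ {A} {B} S A⊆B = begin
    r (B ∪ S) + r A                    ≤⟨ +-mono-≤ (r-mono B∪S⊆) (r-mono (λ x∈A → x∈p∩q⁺ (p⊆p∪q S x∈A , A⊆B x∈A))) ⟩
    r ((A ∪ S) ∪ B) + r ((A ∪ S) ∩ B)  ≤⟨ rk-submod M (A ∪ S) B ⟩
    r (A ∪ S) + r B                    ∎
    where
    open ≤-Reasoning
    B∪S⊆ : B ∪ S ⊆ (A ∪ S) ∪ B
    B∪S⊆ = p⊆r∧q⊆r⇒p∪q⊆r (q⊆p∪q (A ∪ S) B) (p⊆p∪q B ∘ q⊆p∪q A S)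

  inClosure-rk : ∀ {A e} → InClosure A e → r (A ∪ ⁅ e ⁆) ≡ r A
  inClosure-rk e∈cl = ≤-antisym e∈cl (r-mono (p⊆p∪q _))

  inClosure-mono : ∀ {A B e} → A ⊆ B → InClosure A e → InClosure B e
  inClosure-mono {A} {B} {e} A⊆B e∈cl = +-cancelʳ-≤ (r A) _ _ (begin
    r (B ∪ ⁅ e ⁆) + r A  ≤⟨ submodular-⊆ ⁅ e ⁆ A⊆B ⟩
    r (A ∪ ⁅ e ⁆) + r B  ≤⟨ +-monoˡ-≤ (r B) e∈cl ⟩
    r A + r B            ≡⟨ +-comm (r A) (r B) ⟩
    r B + r A            ∎)
    where open ≤-Reasoning

  inClosure-trans : ∀ {A B e f} → InClosure A e → InClosure B f → B ⊆ A ∪ ⁅ e ⁆ → InClosure A f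
  inClosure-trans {A} {B} {e} {f} e∈cl f∈cl B⊆ = begin
    r (A ∪ ⁅ f ⁆)              ≤⟨ r-mono (∪-mono-⊆ (p⊆p∪q ⁅ e ⁆) ⊆-refl) ⟩
    r ((A ∪ ⁅ e ⁆) ∪ ⁅ f ⁆)    ≤⟨ inClosure-mono B⊆ f∈cl ⟩
    r (A ∪ ⁅ e ⁆)              ≤⟨ e∈cl ⟩
    r A                        ∎
    where open ≤-Reasoning

  rk-step-antimono : ∀ {A B e} → A ⊆ B → suc (r B) ≤ r (B ∪ ⁅ e ⁆) → r (A ∪ ⁅ e ⁆) ≡ suc (r A)
  rk-step-antimono {A} {B} {e} A⊆B jump = ≤-antisym (rk-∪⁅⁆≤ A e) (+-cancelʳ-≤ (r B) _ _ (begin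
    suc (r A) + r B      ≡⟨ +-comm (suc (r A)) (r B) ⟩
    r B + suc (r A)      ≡⟨ +-suc (r B) (r A) ⟩
    suc (r B) + r A      ≤⟨ +-monoˡ-≤ (r A) jump ⟩
    r (B ∪ ⁅ e ⁆) + r A  ≤⟨ submodular-⊆ ⁅ e ⁆ A⊆B ⟩
    r (A ∪ ⁅ e ⁆) + r B  ∎))
    where open ≤-Reasoning

  circuit⇒inClosure : ∀ {T a} → IsCircuit M T → a ∈ T → InClosure (T - a) a
  circuit⇒inClosure {T} {a} (dependent , minimal) a∈T = begin
    r ((T - a) ∪ ⁅ a ⁆)  ≡⟨ cong r ([p-x]∪⁅x⁆≡p a∈T) ⟩
    r T                  ≤⟨ ≤-pred (≤-trans dependent ∣T∣≤) ⟩
    ∣ T - a ∣            ≡⟨ minimal (T - a) (x∈p⇒p-x⊂p a∈T) ⟨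
    r (T - a)            ∎
    where
    open ≤-Reasoning
    ∣T∣≤ : ∣ T ∣ ≤ suc ∣ T - a ∣
    ∣T∣≤ = begin
      ∣ T ∣                      ≡⟨ cong ∣_∣ ([p-x]∪⁅x⁆≡p a∈T) ⟨
      ∣ (T - a) ∪ ⁅ a ⁆ ∣        ≤⟨ ∣p∪q∣≤∣p∣+∣q∣ (T - a) ⁅ a ⁆ ⟩
      ∣ T - a ∣ + ∣ ⁅ a ⁆ ∣      ≡⟨ cong (∣ T - a ∣ +_) (∣⁅x⁆∣≡1 a) ⟩
      ∣ T - a ∣ + 1              ≡⟨ +-comm ∣ T - a ∣ 1 ⟩
      suc ∣ T - a ∣              ∎

  triangle⇒inClosure : ∀ {x y z} → IsTriangle M (⁅ x ⁆ ∪ ⁅ y ⁆ ∪ ⁅ z ⁆) → InClosure (⁅ y ⁆ ∪ ⁅ z ⁆) x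
  triangle⇒inClosure {x} {y} {z} (circuit , _) = inClosure-mono T-x⊆ (circuit⇒inClosure circuit x∈⁅x⁆∪p)
    where
    T-x⊆ : (⁅ x ⁆ ∪ ⁅ y ⁆ ∪ ⁅ z ⁆) - x ⊆ ⁅ y ⁆ ∪ ⁅ z ⁆
    T-x⊆ i∈ with x∈⁅y⁆∪p⁻ (p─q⊆p _ ⁅ x ⁆ i∈)
    ... | inj₁ i≡x = ⊥-elim (x∈p-y⇒x≢y i∈ i≡x)
    ... | inj₂ i∈yz = i∈yz

  triangle-rotate : ∀ {x y z} → IsTriangle M (⁅ x ⁆ ∪ ⁅ y ⁆ ∪ ⁅ z ⁆) → IsTriangle M (⁅ y ⁆ ∪ ⁅ z ⁆ ∪ ⁅ x ⁆)
  triangle-rotate {x} {y} {z} = subst (IsTriangle M) (trans (∪-comm ⁅ x ⁆ _) (∪-assoc ⁅ y ⁆ ⁅ z ⁆ ⁅ x ⁆))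

  triangle-flip : ∀ {x y z} → IsTriangle M (⁅ x ⁆ ∪ ⁅ y ⁆ ∪ ⁅ z ⁆) → IsTriangle M (⁅ x ⁆ ∪ ⁅ z ⁆ ∪ ⁅ y ⁆)
  triangle-flip {x} {y} {z} = subst (IsTriangle M) (cong (⁅ x ⁆ ∪_) (∪-comm ⁅ y ⁆ ⁅ z ⁆))

  triangle-distinct : ∀ {x y z} → IsTriangle M (⁅ x ⁆ ∪ ⁅ y ⁆ ∪ ⁅ z ⁆) → x ≢ y
  triangle-distinct {x} {z = z} (_ , size) refl = n≮n 2 (begin
    3                              ≡⟨ size ⟨
    ∣ ⁅ x ⁆ ∪ ⁅ x ⁆ ∪ ⁅ z ⁆ ∣      ≡⟨ cong ∣_∣ (trans (sym (∪-assoc ⁅ x ⁆ ⁅ x ⁆ ⁅ z ⁆)) (cong (_∪ ⁅ z ⁆) (∪-idem ⁅ x ⁆))) ⟩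
    ∣ ⁅ x ⁆ ∪ ⁅ z ⁆ ∣              ≤⟨ ∣⁅x⁆∪⁅y⁆∣≤2 x z ⟩
    2                              ∎)
    where open ≤-Reasoning

  -- the case split is forced by truncated subtraction: for P = ∅ the hypothesis is 0 ≡ 0
  coindependent⇒spanning : ∀ {P} → Indep (dualRk M) P → r ⊤ ≤ r (∁ P)
  coindependent⇒spanning {P} indep with nonempty? P
  ... | yes (x , x∈P) = m+n∸o≡m⇒o≤n ∣ P ∣ (r (∁ P)) (r ⊤) (x∈p⇒0<∣p∣ x∈P) indep
  ... | no empty = r-mono (λ {x} _ → x∉p⇒x∈∁p (λ x∈P → empty (x , x∈P)))

  cocircuit⇒rk-step : ∀ {K e U} → IsCocircuit M K → e ∈ K → U ⊆ ∁ K → r (U ∪ ⁅ e ⁆) ≡ suc (r U)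
  cocircuit⇒rk-step {K} {e} (dependent , minimal) e∈K U⊆∁K = rk-step-antimono U⊆∁K (begin-strict
    r (∁ K)          <⟨ m+n∸o<m⇒n<o ∣ K ∣ (r (∁ K)) (r ⊤) dependent ⟩
    r ⊤              ≤⟨ coindependent⇒spanning (minimal (K - e) (x∈p⇒p-x⊂p e∈K)) ⟩
    r (∁ (K - e))    ≤⟨ r-mono ∁[K-e]⊆ ⟩
    r (∁ K ∪ ⁅ e ⁆)  ∎)
    where
    open ≤-Reasoning
    ∁[K-e]⊆ : ∁ (K - e) ⊆ ∁ K ∪ ⁅ e ⁆
    ∁[K-e]⊆ {x} x∈ with x ≟ e
    ... | yes refl = q⊆p∪q (∁ K) ⁅ x ⁆ (x∈⁅x⁆ x)
    ... | no x≢e = p⊆p∪q ⁅ e ⁆ (x∉p⇒x∈∁p (λ x∈K → x∈∁p⇒x∉p x∈ (x∈p∧x≢y⇒x∈p-y x∈K x≢e)))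

  rk-swap : ∀ a b p → r ((p - a - b) ∪ ⁅ a ⁆) ≡ r ((p - a - b) ∪ ⁅ b ⁆) → r (swap a b p) ≡ r p
  rk-swap a b p exchange = by-cases (a ∈? p) (b ∈? p)
    where
    open ≡-Reasoning
    U : Subset n
    U = p - a - b

    swapped : ∀ x → U ∪ ⁅ x ⁆ ≡ p → r (swap a b p) ≡ r (U ∪ ⁅ transpose a b x ⁆)
    swapped x U∪x≡p = trans (cong (r ∘ swap a b) (sym U∪x≡p))
      (cong r (swap-∪⁅⁆ a b x (λ a∈U → x∈p-y⇒x≢y (p─q⊆p _ ⁅ b ⁆ a∈U) refl) (λ b∈U → x∈p-y⇒x≢y b∈U refl)))

    by-cases : Dec (a ∈ p) → Dec (b ∈ p) → r (swap a b p) ≡ r p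
    by-cases (yes a∈p) (yes b∈p) = cong r (swap-fixes a b (λ _ → b∈p) (λ _ → a∈p))
    by-cases (no a∉p)  (no b∉p)  = cong r (swap-fixes a b (⊥-elim ∘ a∉p) (⊥-elim ∘ b∉p))
    by-cases (yes a∈p) (no b∉p)  = begin
      r (swap a b p)               ≡⟨ swapped a U∪a≡p ⟩
      r (U ∪ ⁅ transpose a b a ⁆)  ≡⟨ cong (λ x → r (U ∪ ⁅ x ⁆)) (transpose-ab-a a b) ⟩
      r (U ∪ ⁅ b ⁆)                ≡⟨ exchange ⟨
      r (U ∪ ⁅ a ⁆)                ≡⟨ cong r U∪a≡p ⟩
      r p                          ∎
      where
      U∪a≡p : U ∪ ⁅ a ⁆ ≡ p
      U∪a≡p = trans (cong (_∪ ⁅ a ⁆) (p-x≡p (b∉p ∘ p─q⊆p p ⁅ a ⁆))) ([p-x]∪⁅x⁆≡p a∈p)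
    by-cases (no a∉p)  (yes b∈p) = begin
      r (swap a b p)               ≡⟨ swapped b U∪b≡p ⟩
      r (U ∪ ⁅ transpose a b b ⁆)  ≡⟨ cong (λ x → r (U ∪ ⁅ x ⁆)) (transpose-ab-b a b) ⟩
      r (U ∪ ⁅ a ⁆)                ≡⟨ exchange ⟩
      r (U ∪ ⁅ b ⁆)                ≡⟨ cong r U∪b≡p ⟩
      r p                          ∎
      where
      U∪b≡p : U ∪ ⁅ b ⁆ ≡ p
      U∪b≡p = trans (cong (λ q → (q - b) ∪ ⁅ b ⁆) (p-x≡p a∉p)) ([p-x]∪⁅x⁆≡p b∈p)

-- Loops and parallel pairs in a 3-connected matroid

module _ {k : ℕ} (N : Matroid k) where

  conn≤rk : ∀ X → conn N X ≤ rk N X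
  conn≤rk X = begin
    (rk N X + rk N (∁ X)) ∸ rk N ⊤  ≤⟨ ∸-monoˡ-≤ (rk N ⊤) (+-monoʳ-≤ (rk N X) (rk-mono N _ _ ⊆⊤)) ⟩
    (rk N X + rk N ⊤) ∸ rk N ⊤      ≡⟨ m+n∸n≡m (rk N X) (rk N ⊤) ⟩
    rk N X                          ∎
    where open ≤-Reasoning

  threeConnected⇒loopless : ThreeConnected N → 2 ≤ k → ∀ j → rk N ⁅ j ⁆ ≢ 0
  threeConnected⇒loopless connected 2≤k j loop = proj₁ (connected ⁅ j ⁆) (small-λ , size , co-size)
    where
    small-λ : suc (conn N ⁅ j ⁆) ≤ 1
    small-λ = s≤s (subst (conn N ⁅ j ⁆ ≤_) loop (conn≤rk ⁅ j ⁆))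
    size : 1 ≤ ∣ ⁅ j ⁆ ∣
    size = ≤-reflexive (sym (∣⁅x⁆∣≡1 j))
    co-size : 1 ≤ ∣ ∁ ⁅ j ⁆ ∣
    co-size = subst (1 ≤_) (sym (trans (∣∁p∣≡n∸∣p∣ ⁅ j ⁆) (cong (k ∸_) (∣⁅x⁆∣≡1 j)))) (∸-monoˡ-≤ 1 2≤k)

  threeConnected⇒simple : ThreeConnected N → 4 ≤ k → ∀ {j j′} → j ≢ j′ → ¬ rk N (⁅ j ⁆ ∪ ⁅ j′ ⁆) ≤ 1
  threeConnected⇒simple connected 4≤k {j} {j′} j≢j′ rk≤1 = proj₂ (connected X) (small-λ , size , co-size)
    where
    X : Subset k
    X = ⁅ j ⁆ ∪ ⁅ j′ ⁆
    small-λ : suc (conn N X) ≤ 2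
    small-λ = s≤s (≤-trans (conn≤rk X) rk≤1)
    size : 2 ≤ ∣ X ∣
    size = subst (_< ∣ X ∣) (∣⁅x⁆∣≡1 j)
      (p⊂q⇒∣p∣<∣q∣ (p⊆p∪q _ , j′ , q⊆p∪q _ _ (x∈⁅x⁆ j′) , x≢y⇒x∉⁅y⁆ (≢-sym j≢j′)))
    co-size : 2 ≤ ∣ ∁ X ∣
    co-size = subst (2 ≤_) (sym (∣∁p∣≡n∸∣p∣ X)) (≤-trans (∸-monoˡ-≤ 2 4≤k) (∸-monoʳ-≤ k (∣⁅x⁆∪⁅y⁆∣≤2 j j′)))

-- Minors

img⁺ : ∀ {k n} (φ : Fin k → Fin n) X {j} → j ∈ X → φ j ∈ img φ X
img⁺ φ (true ∷ X) here = p⊆p∪q _ (x∈⁅x⁆ (φ zero))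
img⁺ φ (_ ∷ X) (there j∈X) = q⊆p∪q _ _ (img⁺ (φ ∘ suc) X j∈X)

img⁻ : ∀ {k n} (φ : Fin k → Fin n) X {i} → i ∈ img φ X → ∃ λ j → j ∈ X × φ j ≡ i
img⁻ φ [] i∈ = ⊥-elim (∉⊥ i∈)
img⁻ φ (b ∷ X) i∈ with x∈p∪q⁻ (if b then ⁅ φ zero ⁆ else ⊥) (img (φ ∘ suc) X) i∈
img⁻ φ (true ∷ X)  _ | inj₁ i∈⁅φ0⁆ = zero , here , sym (x∈⁅y⁆⇒x≡y _ i∈⁅φ0⁆)
img⁻ φ (false ∷ X) _ | inj₁ i∈⊥ = ⊥-elim (∉⊥ i∈⊥)
img⁻ φ (_ ∷ X)     _ | inj₂ i∈img with img⁻ (φ ∘ suc) X i∈img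
... | j , j∈X , φj≡i = suc j , there j∈X , φj≡i

img-⊆ : ∀ {k n} (φ : Fin k → Fin n) {X S} → (∀ {j} → j ∈ X → φ j ∈ S) → img φ X ⊆ S
img-⊆ φ {X} {S} φ[X]⊆S i∈ with img⁻ φ X i∈
... | j , j∈X , refl = φ[X]⊆S j∈X

img-transpose : ∀ {k n} (a b : Fin n) (φ : Fin k → Fin n) X → img (transpose a b ∘ φ) X ≡ swap a b (img φ X)
img-transpose a b φ X = ⊆-antisym to from
  where
  to : img (transpose a b ∘ φ) X ⊆ swap a b (img φ X)
  to i∈ with img⁻ (transpose a b ∘ φ) X i∈
  ... | j , j∈X , refl = tx∈swap⁺ a b (img⁺ φ X j∈X)
  from : swap a b (img φ X) ⊆ img (transpose a b ∘ φ) X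
  from {i} i∈ with img⁻ φ X (x∈swap⁻ a b i∈)
  ... | j , j∈X , φj≡ti = subst (_∈ _) (trans (cong (transpose a b) φj≡ti) (transpose-involutive a b i))
                                 (img⁺ (transpose a b ∘ φ) X j∈X)

module _ {n : ℕ} (M : Matroid n) where

  -- the ranks seen by a minor M / C \ D with C₀ ⊆ C and D₀ ⊆ D are those of sets Y ⊇ C₀ avoiding D₀
  Interchangeable : Fin n → Fin n → Subset n → Subset n → Set
  Interchangeable a b C₀ D₀ = ∀ Y → C₀ ⊆ Y → Empty (Y ∩ D₀) → rk M (swap a b Y) ≡ rk M Y

  interchangeable-mono : ∀ {a b C₀ D₀ C D} → C₀ ⊆ C → D₀ ⊆ D →
                         Interchangeable a b C₀ D₀ → Interchangeable a b C D
  interchangeable-mono C₀⊆C D₀⊆D interchange Y C⊆Y Y∩D=∅ =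
    interchange Y (C⊆Y ∘ C₀⊆C) λ (x , x∈) → Y∩D=∅ (x , x∈p∩q⁺ (proj₁ (x∈p∩q⁻ _ _ x∈) , D₀⊆D (proj₂ (x∈p∩q⁻ _ _ x∈))))

  parallel⇒interchangeable : ∀ {a b A C₀ D₀} → A ⊆ C₀ → a ∉ A → b ∉ A →
    InClosure M (A ∪ ⁅ b ⁆) a → InClosure M (A ∪ ⁅ a ⁆) b → Interchangeable a b C₀ D₀
  parallel⇒interchangeable {a} {b} {A} A⊆C₀ a∉A b∉A a∈cl b∈cl Y C₀⊆Y _ =
    rk-swap M a b Y (≤-antisym (spanned a∈cl) (spanned b∈cl))
    where
    A⊆U : A ⊆ Y - a - b
    A⊆U x∈A = x∈p∧x≢y⇒x∈p-y (x∈p∧x≢y⇒x∈p-y (C₀⊆Y (A⊆C₀ x∈A)) λ { refl → a∉A x∈A }) λ { refl → b∉A x∈A }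
    spanned : ∀ {x y} → InClosure M (A ∪ ⁅ y ⁆) x → rk M ((Y - a - b) ∪ ⁅ x ⁆) ≤ rk M ((Y - a - b) ∪ ⁅ y ⁆)
    spanned x∈cl = ≤-trans (rk-mono M _ _ (∪-mono-⊆ (p⊆p∪q _) ⊆-refl))
                           (inClosure-mono M (∪-mono-⊆ A⊆U ⊆-refl) x∈cl)

  series⇒interchangeable : ∀ {a b K C₀ D₀} → IsCocircuit M K → a ∈ K → b ∈ K →
    (∀ {x} → x ∈ K → x ≢ a → x ≢ b → x ∈ D₀) → Interchangeable a b C₀ D₀
  series⇒interchangeable {a} {b} {K} {D₀ = D₀} cocircuit a∈K b∈K K⊆ Y _ Y∩D₀=∅ =
    rk-swap M a b Y (trans (cocircuit⇒rk-step M cocircuit a∈K U⊆∁K) (sym (cocircuit⇒rk-step M cocircuit b∈K U⊆∁K)))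
    where
    U⊆∁K : Y - a - b ⊆ ∁ K
    U⊆∁K x∈U = x∉p⇒x∈∁p λ x∈K → Y∩D₀=∅ (_ , x∈p∩q⁺ (p─q⊆p _ ⁅ a ⁆ (p─q⊆p _ ⁅ b ⁆ x∈U) ,
                 K⊆ x∈K (x∈p-y⇒x≢y (p─q⊆p _ ⁅ b ⁆ x∈U)) (x∈p-y⇒x≢y x∈U)))

module Minors {n k : ℕ} (M : Matroid n) (N : Matroid k) where

  isoMinor-swap : ∀ {a b C D} → Interchangeable M a b C D → IsoMinor M C D N →
                  IsoMinor M (swap a b C) (swap a b D) N
  isoMinor-swap {a} {b} {C} {D} interchange (C∩D=∅ , φ , φ-inj , φ∉ , onto , rk≡) =
      disjoint , t ∘ φ , injective , avoids , onto′ , rk≡′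
    where
    t : Fin n → Fin n
    t = transpose a b
    swap-C∪D : swap a b C ∪ swap a b D ≡ swap a b (C ∪ D)
    swap-C∪D = sym (swap-∪ a b C D)

    disjoint : Empty (swap a b C ∩ swap a b D)
    disjoint (x , x∈) with x∈p∩q⁻ _ _ x∈
    ... | x∈swapC , x∈swapD = C∩D=∅ (t x , x∈p∩q⁺ (x∈swap⁻ a b x∈swapC , x∈swap⁻ a b x∈swapD))

    injective : ∀ {j j′} → t (φ j) ≡ t (φ j′) → j ≡ j′
    injective eq = φ-inj (trans (sym (transpose-involutive a b _)) (trans (cong t eq) (transpose-involutive a b _)))

    avoids : ∀ j → t (φ j) ∉ swap a b C ∪ swap a b D
    avoids j t[φj]∈ = φ∉ j (tx∈swap⁻ a b (subst (t (φ j) ∈_) swap-C∪D t[φj]∈))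

    onto′ : ∀ i → i ∉ swap a b C ∪ swap a b D → ∃ λ j → t (φ j) ≡ i
    onto′ i i∉ with onto (t i) (λ ti∈ → i∉ (subst (i ∈_) (sym swap-C∪D) (x∈swap⁺ a b ti∈)))
    ... | j , φj≡ti = j , trans (cong t φj≡ti) (transpose-involutive a b i)

    image∩D=∅ : ∀ X → Empty ((img φ X ∪ C) ∩ D)
    image∩D=∅ X (x , x∈) with x∈p∩q⁻ _ _ x∈
    ... | x∈img∪C , x∈D with x∈p∪q⁻ _ _ x∈img∪C
    ...   | inj₂ x∈C = C∩D=∅ (x , x∈p∩q⁺ (x∈C , x∈D))
    ...   | inj₁ x∈img with img⁻ φ X x∈img
    ...     | j , _ , refl = φ∉ j (q⊆p∪q C D x∈D)

    rk≡′ : ∀ X → rk N X + rk M (swap a b C) ≡ rk M (img (t ∘ φ) X ∪ swap a b C)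
    rk≡′ X = begin
      rk N X + rk M (swap a b C)             ≡⟨ cong (rk N X +_) (interchange C ⊆-refl C∩D=∅) ⟩
      rk N X + rk M C                        ≡⟨ rk≡ X ⟩
      rk M (img φ X ∪ C)                     ≡⟨ interchange (img φ X ∪ C) (q⊆p∪q _ _) (image∩D=∅ X) ⟨
      rk M (swap a b (img φ X ∪ C))          ≡⟨ cong (rk M) (swap-∪ a b (img φ X) C) ⟩
      rk M (swap a b (img φ X) ∪ swap a b C) ≡⟨ cong (λ S → rk M (S ∪ swap a b C)) (img-transpose a b φ X) ⟨
      rk M (img (t ∘ φ) X ∪ swap a b C)      ∎
      where open ≡-Reasoning

  isoMinor-contract-loop : ∀ {C D e} → e ∈ C → InClosure M (C - e) e → IsoMinor M C D N →
                           IsoMinor M (C - e) (D ∪ ⁅ e ⁆) N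
  isoMinor-contract-loop {C} {D} {e} e∈C loop (C∩D=∅ , φ , φ-inj , φ∉ , onto , rk≡) =
      disjoint , φ , φ-inj , (λ j → φ∉ j ∘ subst (φ j ∈_) same-support) ,
      (λ i i∉ → onto i (subst (i ∉_) same-support i∉)) , rk≡′
    where
    same-support : (C - e) ∪ (D ∪ ⁅ e ⁆) ≡ C ∪ D
    same-support = begin
      (C - e) ∪ (D ∪ ⁅ e ⁆)   ≡⟨ cong ((C - e) ∪_) (∪-comm D ⁅ e ⁆) ⟩
      (C - e) ∪ (⁅ e ⁆ ∪ D)   ≡⟨ ∪-assoc (C - e) ⁅ e ⁆ D ⟨
      ((C - e) ∪ ⁅ e ⁆) ∪ D   ≡⟨ cong (_∪ D) ([p-x]∪⁅x⁆≡p e∈C) ⟩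
      C ∪ D                   ∎
      where open ≡-Reasoning

    disjoint : Empty ((C - e) ∩ (D ∪ ⁅ e ⁆))
    disjoint (x , x∈) with x∈p∩q⁻ _ _ x∈
    ... | x∈C-e , x∈D∪e with x∈p∪q⁻ D ⁅ e ⁆ x∈D∪e
    ...   | inj₁ x∈D = C∩D=∅ (x , x∈p∩q⁺ (p─q⊆p C ⁅ e ⁆ x∈C-e , x∈D))
    ...   | inj₂ x∈e = x∈p-y⇒x≢y x∈C-e (x∈⁅y⁆⇒x≡y e x∈e)

    redundant : ∀ {S} → C - e ⊆ S → rk M (S ∪ ⁅ e ⁆) ≡ rk M S
    redundant C-e⊆S = inClosure-rk M (inClosure-mono M C-e⊆S loop)

    rk≡′ : ∀ X → rk N X + rk M (C - e) ≡ rk M (img φ X ∪ (C - e))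
    rk≡′ X = begin
      rk N X + rk M (C - e)               ≡⟨ cong (rk N X +_) (trans (sym (redundant ⊆-refl)) (cong (rk M) ([p-x]∪⁅x⁆≡p e∈C))) ⟩
      rk N X + rk M C                     ≡⟨ rk≡ X ⟩
      rk M (img φ X ∪ C)                  ≡⟨ cong (λ S → rk M (img φ X ∪ S)) ([p-x]∪⁅x⁆≡p e∈C) ⟨
      rk M (img φ X ∪ (C - e) ∪ ⁅ e ⁆)    ≡⟨ cong (rk M) (∪-assoc (img φ X) (C - e) ⁅ e ⁆) ⟨
      rk M ((img φ X ∪ (C - e)) ∪ ⁅ e ⁆)  ≡⟨ redundant (q⊆p∪q (img φ X) (C - e)) ⟩
      rk M (img φ X ∪ (C - e))            ∎
      where open ≡-Reasoning

  isoMinor-no-loop : ∀ {C D e} → ThreeConnected N → 2 ≤ k → IsoMinor M C D N → e ∉ C ∪ D → ¬ InClosure M C e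
  isoMinor-no-loop {C} connected 2≤k (_ , φ , _ , _ , onto , rk≡) e∉ e∈cl with onto _ e∉
  ... | j , refl = threeConnected⇒loopless N connected 2≤k j (n≤0⇒n≡0 (+-cancelʳ-≤ (rk M C) _ _ (begin
    rk N ⁅ j ⁆ + rk M C     ≡⟨ rk≡ ⁅ j ⁆ ⟩
    rk M (img φ ⁅ j ⁆ ∪ C)  ≤⟨ rk-mono M _ _ (p⊆r∧q⊆r⇒p∪q⊆r (q⊆p∪q C _ ∘ img-⊆ φ φ[⁅j⁆]) (p⊆p∪q _)) ⟩
    rk M (C ∪ ⁅ φ j ⁆)      ≤⟨ e∈cl ⟩
    rk M C                  ∎)))
    where
    open ≤-Reasoning
    φ[⁅j⁆] : ∀ {j′} → j′ ∈ ⁅ j ⁆ → φ j′ ∈ ⁅ φ j ⁆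
    φ[⁅j⁆] j′∈ rewrite x∈⁅y⁆⇒x≡y j j′∈ = x∈⁅x⁆ (φ j)

  isoMinor-no-parallel : ∀ {C D e f} → ThreeConnected N → 4 ≤ k → IsoMinor M C D N →
    e ∉ C ∪ D → f ∉ C ∪ D → e ≢ f → ¬ rk M (C ∪ ⁅ e ⁆ ∪ ⁅ f ⁆) ≤ suc (rk M C)
  isoMinor-no-parallel {C} connected 4≤k (_ , φ , _ , _ , onto , rk≡) e∉ f∉ e≢f small with onto _ e∉ | onto _ f∉
  ... | j , refl | j′ , refl =
    threeConnected⇒simple N connected 4≤k (e≢f ∘ cong φ) (+-cancelʳ-≤ (rk M C) _ _ (begin
      rk N (⁅ j ⁆ ∪ ⁅ j′ ⁆) + rk M C     ≡⟨ rk≡ (⁅ j ⁆ ∪ ⁅ j′ ⁆) ⟩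
      rk M (img φ (⁅ j ⁆ ∪ ⁅ j′ ⁆) ∪ C)  ≤⟨ rk-mono M _ _ (p⊆r∧q⊆r⇒p∪q⊆r (q⊆p∪q C _ ∘ img-⊆ φ φ[pair]) (p⊆p∪q _)) ⟩
      rk M (C ∪ ⁅ φ j ⁆ ∪ ⁅ φ j′ ⁆)      ≤⟨ small ⟩
      suc (rk M C)                       ∎))
    where
    open ≤-Reasoning
    φ[pair] : ∀ {j″} → j″ ∈ ⁅ j ⁆ ∪ ⁅ j′ ⁆ → φ j″ ∈ ⁅ φ j ⁆ ∪ ⁅ φ j′ ⁆
    φ[pair] j″∈ with x∈⁅y⁆∪p⁻ j″∈
    ... | inj₁ refl = x∈⁅x⁆∪p
    ... | inj₂ j″∈⁅j′⁆ rewrite x∈⁅y⁆⇒x≡y j′ j″∈⁅j′⁆ = x∈p⇒x∈⁅y⁆∪p (x∈⁅x⁆ (φ j′))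


  hasMinorOf-weaken : ∀ {C₀ D₀ C₁ D₁} → C₁ ⊆ C₀ → D₁ ⊆ D₀ → HasMinorOf M C₀ D₀ N → HasMinorOf M C₁ D₁ N
  hasMinorOf-weaken C₁⊆C₀ D₁⊆D₀ (C , D , C₀⊆C , D₀⊆D , iso) = C , D , C₀⊆C ∘ C₁⊆C₀ , D₀⊆D ∘ D₁⊆D₀ , iso

  hasMinorOf-swap : ∀ {a b C₀ D₀} → Interchangeable M a b C₀ D₀ → HasMinorOf M C₀ D₀ N →
                    HasMinorOf M (swap a b C₀) (swap a b D₀) N
  hasMinorOf-swap {a} {b} interchange (C , D , C₀⊆C , D₀⊆D , iso) =
    swap a b C , swap a b D , swap-mono a b C₀⊆C , swap-mono a b D₀⊆D ,
    isoMinor-swap (interchangeable-mono M C₀⊆C D₀⊆D interchange) iso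

  hasMinorOf-delete-loop : ∀ {A D₀ e} → ThreeConnected N → 2 ≤ k → e ∉ A → InClosure M A e →
                           HasMinorOf M A D₀ N → HasMinorOf M A (D₀ ∪ ⁅ e ⁆) N
  hasMinorOf-delete-loop {A} {e = e} connected 2≤k e∉A e∈cl (C , D , A⊆C , D₀⊆D , iso) with e ∈? C | e ∈? D
  ... | yes e∈C | _ = C - e , D ∪ ⁅ e ⁆ , A⊆C-e , ∪-mono-⊆ D₀⊆D ⊆-refl ,
                      isoMinor-contract-loop e∈C (inClosure-mono M A⊆C-e e∈cl) iso
    where
    A⊆C-e : A ⊆ C - e
    A⊆C-e x∈A = x∈p∧x≢y⇒x∈p-y (A⊆C x∈A) λ { refl → e∉A x∈A }
  ... | no _ | yes e∈D = C , D , A⊆C , p⊆r∧q⊆r⇒p∪q⊆r D₀⊆D (x∈q⇒⁅x⁆⊆q e∈D) , iso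
  ... | no e∉C | no e∉D =
    ⊥-elim (isoMinor-no-loop connected 2≤k iso (x∉p∧x∉q⇒x∉p∪q e∉C e∉D) (inClosure-mono M A⊆C e∈cl))

  hasMinorOf-delete-parallel : ∀ {A D₀ a b} → ThreeConnected N → 4 ≤ k → a ∉ A → b ∉ D₀ → a ≢ b →
    InClosure M (A ∪ ⁅ b ⁆) a → InClosure M (A ∪ ⁅ a ⁆) b →
    HasMinorOf M A D₀ N → HasMinorOf M A (D₀ ∪ ⁅ a ⁆) N
  hasMinorOf-delete-parallel {A} {D₀} {a} {b} connected 4≤k a∉A b∉D₀ a≢b a∈cl b∈cl (C , D , A⊆C , D₀⊆D , iso)
    with a ∈? D | b ∈? D | b ∈? C | a ∈? C
  ... | yes a∈D | _ | _ | _ = C , D , A⊆C , p⊆r∧q⊆r⇒p∪q⊆r D₀⊆D (x∈q⇒⁅x⁆⊆q a∈D) , iso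
  ... | no a∉D | yes b∈D | _ | _ =
    swap a b C , swap a b D , p⊆swap a b A⊆C a∉A b∉A , D₀∪a⊆swapD ,
    isoMinor-swap (parallel⇒interchangeable M A⊆C a∉A b∉A a∈cl b∈cl) iso
    where
    b∉A : b ∉ A
    b∉A b∈A = proj₁ iso (b , x∈p∩q⁺ (A⊆C b∈A , b∈D))
    D₀∪a⊆swapD : D₀ ∪ ⁅ a ⁆ ⊆ swap a b D
    D₀∪a⊆swapD = p⊆r∧q⊆r⇒p∪q⊆r (p⊆swap a b D₀⊆D (a∉D ∘ D₀⊆D) b∉D₀) (x∈q⇒⁅x⁆⊆q (a∈swap a b b∈D))
  ... | no _ | no _ | yes b∈C | _ =
    hasMinorOf-weaken (p⊆p∪q ⁅ b ⁆) ⊆-refl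
      (hasMinorOf-delete-loop connected (≤-trans (s≤s (s≤s z≤n)) 4≤k) (x∉p∧x∉q⇒x∉p∪q a∉A (x≢y⇒x∉⁅y⁆ a≢b)) a∈cl
        (C , D , p⊆r∧q⊆r⇒p∪q⊆r A⊆C (x∈q⇒⁅x⁆⊆q b∈C) , D₀⊆D , iso))
  ... | no _ | no b∉D | no b∉C | yes a∈C =
    ⊥-elim (isoMinor-no-loop connected (≤-trans (s≤s (s≤s z≤n)) 4≤k) iso (x∉p∧x∉q⇒x∉p∪q b∉C b∉D)
              (inClosure-mono M (p⊆r∧q⊆r⇒p∪q⊆r A⊆C (x∈q⇒⁅x⁆⊆q a∈C)) b∈cl))
  ... | no a∉D | no b∉D | no b∉C | no a∉C =
    ⊥-elim (isoMinor-no-parallel connected 4≤k iso (x∉p∧x∉q⇒x∉p∪q a∉C a∉D) (x∉p∧x∉q⇒x∉p∪q b∉C b∉D) a≢b (begin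
      rk M (C ∪ ⁅ a ⁆ ∪ ⁅ b ⁆)    ≡⟨ cong (rk M) (∪-assoc C ⁅ a ⁆ ⁅ b ⁆) ⟨
      rk M ((C ∪ ⁅ a ⁆) ∪ ⁅ b ⁆)  ≤⟨ inClosure-mono M (∪-mono-⊆ A⊆C ⊆-refl) b∈cl ⟩
      rk M (C ∪ ⁅ a ⁆)            ≤⟨ rk-∪⁅⁆≤ M C a ⟩
      suc (rk M C)                ∎))
    where open ≤-Reasoning

  module _ {a b c : Fin n} (triangle : IsTriangle M (⁅ a ⁆ ∪ ⁅ b ⁆ ∪ ⁅ c ⁆)) where

    private
      triangle-cab : IsTriangle M (⁅ c ⁆ ∪ ⁅ a ⁆ ∪ ⁅ b ⁆)
      triangle-cab = triangle-rotate M (triangle-rotate M triangle)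

      a∉⁅b⁆ : a ∉ ⁅ b ⁆
      a∉⁅b⁆ = x≢y⇒x∉⁅y⁆ (triangle-distinct M triangle)

      c∉⁅b⁆ : c ∉ ⁅ b ⁆
      c∉⁅b⁆ = x≢y⇒x∉⁅y⁆ (≢-sym (triangle-distinct M (triangle-rotate M triangle)))

    triangle-delete-third : ThreeConnected N → 2 ≤ k →
      HasMinorOf M (⁅ a ⁆ ∪ ⁅ b ⁆) ⊥ N → HasMinorOf M (⁅ a ⁆ ∪ ⁅ b ⁆) ⁅ c ⁆ N
    triangle-delete-third connected 2≤k =
      hasMinorOf-weaken ⊆-refl (q⊆p∪q ⊥ ⁅ c ⁆) ∘
      hasMinorOf-delete-loop connected 2≤k (x∉p∧x∉q⇒x∉p∪q (x≢y⇒x∉⁅y⁆ (triangle-distinct M triangle-cab)) c∉⁅b⁆)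
                             (triangle⇒inClosure M triangle-cab)

    triangle-exchange : HasMinorOf M (⁅ a ⁆ ∪ ⁅ b ⁆) ⁅ c ⁆ N → HasMinorOf M (⁅ c ⁆ ∪ ⁅ b ⁆) ⁅ a ⁆ N
    triangle-exchange =
      hasMinorOf-weaken cb⊆ (x∈q⇒⁅x⁆⊆q (a∈swap a c (x∈⁅x⁆ c))) ∘
      hasMinorOf-swap (parallel⇒interchangeable M (q⊆p∪q ⁅ a ⁆ ⁅ b ⁆) a∉⁅b⁆ c∉⁅b⁆
                        (triangle⇒inClosure M triangle) (triangle⇒inClosure M (triangle-flip M triangle-cab)))
      where
      cb⊆ : ⁅ c ⁆ ∪ ⁅ b ⁆ ⊆ swap a c (⁅ a ⁆ ∪ ⁅ b ⁆)
      cb⊆ = p⊆r∧q⊆r⇒p∪q⊆r (x∈q⇒⁅x⁆⊆q (b∈swap a c x∈⁅x⁆∪p)) (p⊆swap a c {q = ⁅ a ⁆ ∪ ⁅ b ⁆} (q⊆p∪q ⁅ a ⁆ ⁅ b ⁆) a∉⁅b⁆ c∉⁅b⁆)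


module Configuration {n k : ℕ} (M : Matroid n) (N : Matroid k) (e₁ e₂ e₃ e₄ e₅ e₆ e₇ : Fin n)
  (T₁ : IsTriangle M (⁅ e₁ ⁆ ∪ ⁅ e₂ ⁆ ∪ ⁅ e₃ ⁆))
  (T₂ : IsTriangle M (⁅ e₄ ⁆ ∪ ⁅ e₅ ⁆ ∪ ⁅ e₆ ⁆))
  (T₁∩T₂=∅ : Empty ((⁅ e₁ ⁆ ∪ ⁅ e₂ ⁆ ∪ ⁅ e₃ ⁆) ∩ (⁅ e₄ ⁆ ∪ ⁅ e₅ ⁆ ∪ ⁅ e₆ ⁆)))
  (K : IsCocircuit M (⁅ e₂ ⁆ ∪ ⁅ e₃ ⁆ ∪ ⁅ e₄ ⁆ ∪ ⁅ e₅ ⁆))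
  (T₃ : IsTriangle M (⁅ e₂ ⁆ ∪ ⁅ e₄ ⁆ ∪ ⁅ e₇ ⁆))
  (connected : ThreeConnected N) (4≤k : 4 ≤ k) where

  open Minors M N

  private
    2≤k : 2 ≤ k
    2≤k = ≤-trans (s≤s (s≤s z≤n)) 4≤k

    T₁≢T₂ : ∀ {x y} → x ∈ ⁅ e₁ ⁆ ∪ ⁅ e₂ ⁆ ∪ ⁅ e₃ ⁆ → y ∈ ⁅ e₄ ⁆ ∪ ⁅ e₅ ⁆ ∪ ⁅ e₆ ⁆ → x ≢ y
    T₁≢T₂ x∈T₁ y∈T₂ refl = T₁∩T₂=∅ (_ , x∈p∩q⁺ (x∈T₁ , y∈T₂))

    1st : ∀ {x y z : Fin n} → x ∈ ⁅ x ⁆ ∪ ⁅ y ⁆ ∪ ⁅ z ⁆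
    1st = x∈⁅x⁆∪p
    2nd : ∀ {x y z : Fin n} → y ∈ ⁅ x ⁆ ∪ ⁅ y ⁆ ∪ ⁅ z ⁆
    2nd = x∈p⇒x∈⁅y⁆∪p x∈⁅x⁆∪p
    3rd : ∀ {x y z : Fin n} → z ∈ ⁅ x ⁆ ∪ ⁅ y ⁆ ∪ ⁅ z ⁆
    3rd = x∈p⇒x∈⁅y⁆∪p (x∈p⇒x∈⁅y⁆∪p (x∈⁅x⁆ _))

    contract-comm : ∀ {x y D₀} → HasMinorOf M (⁅ x ⁆ ∪ ⁅ y ⁆) D₀ N → HasMinorOf M (⁅ y ⁆ ∪ ⁅ x ⁆) D₀ N
    contract-comm = hasMinorOf-weaken (⊆-reflexive (∪-comm _ _)) ⊆-refl

  contract56⇒contract56-delete4 : HasMinorOf M (⁅ e₅ ⁆ ∪ ⁅ e₆ ⁆) ⊥ N → HasMinorOf M (⁅ e₅ ⁆ ∪ ⁅ e₆ ⁆) ⁅ e₄ ⁆ N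
  contract56⇒contract56-delete4 = triangle-delete-third (triangle-rotate M T₂) connected 2≤k

  contract45⇒contract56-delete4 : HasMinorOf M (⁅ e₄ ⁆ ∪ ⁅ e₅ ⁆) ⊥ N → HasMinorOf M (⁅ e₅ ⁆ ∪ ⁅ e₆ ⁆) ⁅ e₄ ⁆ N
  contract45⇒contract56-delete4 = contract-comm ∘ triangle-exchange T₂ ∘ triangle-delete-third T₂ connected 2≤k

  contract46⇒contract56-delete4 : HasMinorOf M (⁅ e₄ ⁆ ∪ ⁅ e₆ ⁆) ⊥ N → HasMinorOf M (⁅ e₅ ⁆ ∪ ⁅ e₆ ⁆) ⁅ e₄ ⁆ N
  contract46⇒contract56-delete4 =
    triangle-exchange (triangle-flip M T₂) ∘ triangle-delete-third (triangle-flip M T₂) connected 2≤k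

  contract-pair-of-T₂⇒contract56-delete4 : ∀ {x y} →
    x ∈ ⁅ e₄ ⁆ ∪ ⁅ e₅ ⁆ ∪ ⁅ e₆ ⁆ → y ∈ ⁅ e₄ ⁆ ∪ ⁅ e₅ ⁆ ∪ ⁅ e₆ ⁆ → x ≢ y →
    HasMinorOf M (⁅ x ⁆ ∪ ⁅ y ⁆) ⊥ N → HasMinorOf M (⁅ e₅ ⁆ ∪ ⁅ e₆ ⁆) ⁅ e₄ ⁆ N
  contract-pair-of-T₂⇒contract56-delete4 x∈T₂ y∈T₂ x≢y with x∈⁅a⁆∪⁅b⁆∪⁅c⁆⁻ x∈T₂ | x∈⁅a⁆∪⁅b⁆∪⁅c⁆⁻ y∈T₂
  ... | inj₁ refl        | inj₂ (inj₁ refl) = contract45⇒contract56-delete4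
  ... | inj₂ (inj₁ refl) | inj₁ refl        = contract45⇒contract56-delete4 ∘ contract-comm
  ... | inj₁ refl        | inj₂ (inj₂ refl) = contract46⇒contract56-delete4
  ... | inj₂ (inj₂ refl) | inj₁ refl        = contract46⇒contract56-delete4 ∘ contract-comm
  ... | inj₂ (inj₁ refl) | inj₂ (inj₂ refl) = contract56⇒contract56-delete4
  ... | inj₂ (inj₂ refl) | inj₂ (inj₁ refl) = contract56⇒contract56-delete4 ∘ contract-comm
  ... | inj₁ refl        | inj₁ refl        = ⊥-elim (x≢y refl)
  ... | inj₂ (inj₁ refl) | inj₂ (inj₁ refl) = ⊥-elim (x≢y refl)
  ... | inj₂ (inj₂ refl) | inj₂ (inj₂ refl) = ⊥-elim (x≢y refl)

  contract56-delete4⇒contract5-delete24 :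
    HasMinorOf M (⁅ e₅ ⁆ ∪ ⁅ e₆ ⁆) ⁅ e₄ ⁆ N → HasMinorOf M ⁅ e₅ ⁆ (⁅ e₂ ⁆ ∪ ⁅ e₄ ⁆) N
  contract56-delete4⇒contract5-delete24 =
    hasMinorOf-weaken (p⊆p∪q ⁅ e₆ ⁆) (⊆-reflexive (∪-comm ⁅ e₂ ⁆ ⁅ e₄ ⁆)) ∘
    hasMinorOf-delete-parallel connected 4≤k e₂∉⁅e₅⁆∪⁅e₆⁆ e₇∉⁅e₄⁆ e₂≢e₇
      (via-e₄ (triangle⇒inClosure M T₃) ⊆-refl)
      (via-e₄ (triangle⇒inClosure M (triangle-rotate M (triangle-rotate M T₃))) (⊆-reflexive (∪-comm ⁅ e₂ ⁆ ⁅ e₄ ⁆)))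
    where
    e₂∉⁅e₅⁆∪⁅e₆⁆ : e₂ ∉ ⁅ e₅ ⁆ ∪ ⁅ e₆ ⁆
    e₂∉⁅e₅⁆∪⁅e₆⁆ = x∉p∧x∉q⇒x∉p∪q (x≢y⇒x∉⁅y⁆ (T₁≢T₂ 2nd 2nd)) (x≢y⇒x∉⁅y⁆ (T₁≢T₂ 2nd 3rd))
    e₇∉⁅e₄⁆ : e₇ ∉ ⁅ e₄ ⁆
    e₇∉⁅e₄⁆ = x≢y⇒x∉⁅y⁆ (≢-sym (triangle-distinct M (triangle-rotate M T₃)))
    e₂≢e₇ : e₂ ≢ e₇
    e₂≢e₇ = ≢-sym (triangle-distinct M (triangle-rotate M (triangle-rotate M T₃)))
    via-e₄ : ∀ {u w B} → InClosure M B w → B ⊆ ⁅ e₄ ⁆ ∪ ⁅ u ⁆ → InClosure M ((⁅ e₅ ⁆ ∪ ⁅ e₆ ⁆) ∪ ⁅ u ⁆) w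
    via-e₄ {u} w∈cl B⊆ =
      inClosure-trans M (inClosure-mono M (p⊆p∪q ⁅ u ⁆) (triangle⇒inClosure M T₂)) w∈cl
        (⊆-trans B⊆ (p⊆r∧q⊆r⇒p∪q⊆r (q⊆p∪q _ ⁅ e₄ ⁆) (p⊆p∪q ⁅ e₄ ⁆ ∘ q⊆p∪q (⁅ e₅ ⁆ ∪ ⁅ e₆ ⁆) ⁅ u ⁆)))

  contract5-delete24⇒contract3-delete24 :
    HasMinorOf M ⁅ e₅ ⁆ (⁅ e₂ ⁆ ∪ ⁅ e₄ ⁆) N → HasMinorOf M ⁅ e₃ ⁆ (⁅ e₂ ⁆ ∪ ⁅ e₄ ⁆) N
  contract5-delete24⇒contract3-delete24 =
    hasMinorOf-weaken (x∈q⇒⁅x⁆⊆q (b∈swap e₅ e₃ (x∈⁅x⁆ e₅))) (p⊆swap e₅ e₃ ⊆-refl e₅∉⁅e₂⁆∪⁅e₄⁆ e₃∉⁅e₂⁆∪⁅e₄⁆) ∘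
    hasMinorOf-swap (series⇒interchangeable M K (x∈p⇒x∈⁅y⁆∪p 3rd) (x∈p⇒x∈⁅y⁆∪p x∈⁅x⁆∪p) K-e₅-e₃⊆)
    where
    e₅∉⁅e₂⁆∪⁅e₄⁆ : e₅ ∉ ⁅ e₂ ⁆ ∪ ⁅ e₄ ⁆
    e₅∉⁅e₂⁆∪⁅e₄⁆ = x∉p∧x∉q⇒x∉p∪q (x≢y⇒x∉⁅y⁆ (≢-sym (T₁≢T₂ 2nd 2nd)))
                                  (x≢y⇒x∉⁅y⁆ (≢-sym (triangle-distinct M T₂)))
    e₃∉⁅e₂⁆∪⁅e₄⁆ : e₃ ∉ ⁅ e₂ ⁆ ∪ ⁅ e₄ ⁆
    e₃∉⁅e₂⁆∪⁅e₄⁆ = x∉p∧x∉q⇒x∉p∪q (x≢y⇒x∉⁅y⁆ (≢-sym (triangle-distinct M (triangle-rotate M T₁))))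
                                  (x≢y⇒x∉⁅y⁆ (T₁≢T₂ 3rd 1st))
    K-e₅-e₃⊆ : ∀ {x} → x ∈ ⁅ e₂ ⁆ ∪ ⁅ e₃ ⁆ ∪ ⁅ e₄ ⁆ ∪ ⁅ e₅ ⁆ → x ≢ e₅ → x ≢ e₃ → x ∈ ⁅ e₂ ⁆ ∪ ⁅ e₄ ⁆
    K-e₅-e₃⊆ x∈K x≢e₅ x≢e₃ with x∈⁅y⁆∪p⁻ x∈K
    ... | inj₁ refl = x∈⁅x⁆∪p
    ... | inj₂ x∈345 with x∈⁅a⁆∪⁅b⁆∪⁅c⁆⁻ x∈345
    ...   | inj₁ x≡e₃ = ⊥-elim (x≢e₃ x≡e₃)
    ...   | inj₂ (inj₁ refl) = x∈p⇒x∈⁅y⁆∪p (x∈⁅x⁆ _)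
    ...   | inj₂ (inj₂ x≡e₅) = ⊥-elim (x≢e₅ x≡e₅)

  contract3-delete24⇒delete14 :
    HasMinorOf M ⁅ e₃ ⁆ (⁅ e₂ ⁆ ∪ ⁅ e₄ ⁆) N → HasMinorOf M ⊥ (⁅ e₁ ⁆ ∪ ⁅ e₄ ⁆) N
  contract3-delete24⇒delete14 =
    hasMinorOf-weaken ⊥⊆ ⁅e₁⁆∪⁅e₄⁆⊆ ∘
    hasMinorOf-swap (parallel⇒interchangeable M ⊆-refl e₁∉⁅e₃⁆ e₂∉⁅e₃⁆
                      (triangle⇒inClosure M (triangle-flip M T₁)) (triangle⇒inClosure M (triangle-rotate M T₁)))
    where
    e₁∉⁅e₃⁆ : e₁ ∉ ⁅ e₃ ⁆
    e₁∉⁅e₃⁆ = x≢y⇒x∉⁅y⁆ (≢-sym (triangle-distinct M (triangle-rotate M (triangle-rotate M T₁))))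
    e₂∉⁅e₃⁆ : e₂ ∉ ⁅ e₃ ⁆
    e₂∉⁅e₃⁆ = x≢y⇒x∉⁅y⁆ (triangle-distinct M (triangle-rotate M T₁))
    ⁅e₁⁆∪⁅e₄⁆⊆ : ⁅ e₁ ⁆ ∪ ⁅ e₄ ⁆ ⊆ swap e₁ e₂ (⁅ e₂ ⁆ ∪ ⁅ e₄ ⁆)
    ⁅e₁⁆∪⁅e₄⁆⊆ = p⊆r∧q⊆r⇒p∪q⊆r (x∈q⇒⁅x⁆⊆q (a∈swap e₁ e₂ x∈⁅x⁆∪p))
      (p⊆swap e₁ e₂ {q = ⁅ e₂ ⁆ ∪ ⁅ e₄ ⁆} (q⊆p∪q ⁅ e₂ ⁆ ⁅ e₄ ⁆)
              (x≢y⇒x∉⁅y⁆ (T₁≢T₂ 1st 1st)) (x≢y⇒x∉⁅y⁆ (T₁≢T₂ 2nd 1st)))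

lemma7p1 : ∀ {n k} (M : Matroid n) (N : Matroid k)
    (e₁ e₂ e₃ e₄ e₅ e₆ e₇ : Fin n) →
    InternallyFourConnected M → Binary M →
    IsTriangle M (⁅ e₁ ⁆ ∪ ⁅ e₂ ⁆ ∪ ⁅ e₃ ⁆) →
    IsTriangle M (⁅ e₄ ⁆ ∪ ⁅ e₅ ⁆ ∪ ⁅ e₆ ⁆) →
    Empty ((⁅ e₁ ⁆ ∪ ⁅ e₂ ⁆ ∪ ⁅ e₃ ⁆) ∩ (⁅ e₄ ⁆ ∪ ⁅ e₅ ⁆ ∪ ⁅ e₆ ⁆)) →
    IsCocircuit M (⁅ e₂ ⁆ ∪ ⁅ e₃ ⁆ ∪ ⁅ e₄ ⁆ ∪ ⁅ e₅ ⁆) →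
    IsTriangle M (⁅ e₂ ⁆ ∪ ⁅ e₄ ⁆ ∪ ⁅ e₇ ⁆) →
    InternallyFourConnected N → 7 ≤ k →
    (∃₂ λ x y → (x ∈ ⁅ e₄ ⁆ ∪ ⁅ e₅ ⁆ ∪ ⁅ e₆ ⁆) × (y ∈ ⁅ e₄ ⁆ ∪ ⁅ e₅ ⁆ ∪ ⁅ e₆ ⁆) × x ≢ y ×
       HasMinorOf M (⁅ x ⁆ ∪ ⁅ y ⁆) ⊥ N) →
    HasMinorOf M ⊥ (⁅ e₁ ⁆ ∪ ⁅ e₄ ⁆) N
lemma7p1 M N e₁ e₂ e₃ e₄ e₅ e₆ e₇ _ _ T₁ T₂ T₁∩T₂=∅ K T₃ (connected , _) 7≤k
         (x , y , x∈T₂ , y∈T₂ , x≢y , M/xy) =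
  contract3-delete24⇒delete14
    (contract5-delete24⇒contract3-delete24
      (contract56-delete4⇒contract5-delete24
        (contract-pair-of-T₂⇒contract56-delete4 x∈T₂ y∈T₂ x≢y M/xy)))
  where
  open Configuration M N e₁ e₂ e₃ e₄ e₅ e₆ e₇ T₁ T₂ T₁∩T₂=∅ K T₃ connected
                     (≤-trans (s≤s (s≤s (s≤s (s≤s z≤n)))) 7≤k)
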